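{- $S\subseteq P$; that is, every term of the TRIP-Stern sequence for $(e,e,e)$ is either $(1,1,1)$ or an integer triple $(x,y,z)$ with $0<x\le y<z$.
   Context: Let $A_0=\begin{pmatrix}0&0&1\\1&0&0\\0&1&1\end{pmatrix}$, $A_1=\begin{pmatrix}1&0&1\\0&1&0\\0&0&1\end{pmatrix}$, so that for row vectors $(x,y,z)A_0=(y,z,x+z)$ and $(x,y,z)A_1=(x,y,x+z)$. The TRIP-Stern sequence for $(e,e,e)$ is defined by $a_1=(1,1,1)$, $a_{2n}=a_nA_0$, $a_{2n+1}=a_nA_1$ for $n\ge1$. Let $S$ be the set of triples occurring in this sequence and $P=\{(x,y,z)\in\mathbb Z^3:0<x\le y<z\}\cup\{(1,1,1)\}$. -}

module Defs where

open import Data.Nat using (ℕ; zero; suc; _≤?_)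
open import Data.Nat.DivMod using (_/_; _%_)
open import Data.Integer using (ℤ; +_; _+_; _≤_; _<_)
open import Data.Product using (_×_; _,_; Σ; ∃)
open import Data.Sum using (_⊎_)
open import Relation.Binary.PropositionalEquality using (_≡_)
open import Relation.Nullary using (yes; no)

Triple : Set
Triple = ℤ × ℤ × ℤ

A₀ : Triple → Triple
A₀ (x , y , z) = (y , z , x + z)

A₁ : Triple → Triple
A₁ (x , y , z) = (x , y , x + z)

-- e = 1
one : Triple
one = (+ 1 , + 1 , + 1)

-- fuel-driven evaluation of the recursion a₁ = (1,1,1), a₂ₙ = aₙA₀, a₂ₙ₊₁ = aₙA₁.
-- With fuel ≥ n the result is independent of the fuel (each step halves n).
aFuel : ℕ → ℕ → Triple
aFuel zero    n = one
aFuel (suc f) n with n ≤? 1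
... | yes _ = one
... | no  _ with n % 2
...   | zero = A₀ (aFuel f (n / 2))
...   | suc _ = A₁ (aFuel f (n / 2))

-- the TRIP-Stern sequence for (e,e,e); only meaningful for n ≥ 1
tripStern : ℕ → Triple
tripStern n = aFuel n n

InS : Triple → Set
InS t = Σ ℕ (λ n → (1 Data.Nat.≤ n) × tripStern n ≡ t)

InP : Triple → Set
InP (x , y , z) = ((+ 0 < x) × (x ≤ y) × (y < z)) ⊎ ((x , y , z) ≡ one)

-- P is closed under both A₀ and A₁: from 0 < x ≤ y < z one gets 0 < y ≤ z < x + z and
-- 0 < x ≤ y < x + z, and (1,1,1) is sent to (1,1,2). Every term arises from (1,1,1) by these maps.

module Submission where

open import Defs
open import Data.Nat using (ℕ; zero; suc; _≤?_; s≤s; z≤n)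
open import Data.Nat.DivMod using (_/_; _%_)
open import Data.Integer using (ℤ; +_; _+_; _<_; +<+; +≤+)
open import Data.Integer.Properties using (<-trans; <-≤-trans; <⇒≤; +-monoˡ-<; +-identityˡ)
open import Data.Product using (_,_)
open import Data.Sum using (inj₁; inj₂)
open import Relation.Binary.PropositionalEquality using (refl; subst)
open import Relation.Nullary using (yes; no)

<-+-pos : ∀ {x z : ℤ} → + 0 < x → z < x + z
<-+-pos {x} {z} 0<x = subst (_< x + z) (+-identityˡ z) (+-monoˡ-< z 0<x)

one-step-InP : InP (+ 1 , + 1 , + 2)
one-step-InP = inj₁ (+<+ (s≤s z≤n) , +≤+ (s≤s z≤n) , +<+ (s≤s (s≤s z≤n)))

A₀-preserves-InP : ∀ t → InP t → InP (A₀ t)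
A₀-preserves-InP _ (inj₁ (0<x , x≤y , y<z)) = inj₁ (<-≤-trans 0<x x≤y , <⇒≤ y<z , <-+-pos 0<x)
A₀-preserves-InP _ (inj₂ refl)              = one-step-InP

A₁-preserves-InP : ∀ t → InP t → InP (A₁ t)
A₁-preserves-InP _ (inj₁ (0<x , x≤y , y<z)) = inj₁ (0<x , x≤y , <-trans y<z (<-+-pos 0<x))
A₁-preserves-InP _ (inj₂ refl)              = one-step-InP

aFuel-InP : ∀ fuel n → InP (aFuel fuel n)
aFuel-InP zero       n = inj₂ refl
aFuel-InP (suc fuel) n with n ≤? 1
... | yes _ = inj₂ refl
... | no  _ with n % 2
...   | zero  = A₀-preserves-InP _ (aFuel-InP fuel (n / 2))
...   | suc _ = A₁-preserves-InP _ (aFuel-InP fuel (n / 2))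

proposition28 : ∀ (t : Triple) → InS t → InP t
proposition28 t (n , _ , refl) = aFuel-InP n n
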